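{- Let $n\ge2$ and consider a run of $G_n$, all of whose words share the same first $n-1$ letters $a_1\cdots a_{n-1}$. Let $k$ be the least index $k'\in\{2,\ldots,n-1\}$ such that $a_j\ge 2k'-1$ for all $j\in\{k',k'+1,\ldots,n-1\}$, if such an index exists, and $k=n$ otherwise. Then for every word $\underline{a}=a_1\cdots a_{n-1}a_n$ of this run: if $a_n\le 2k-2$ then $\underline{a}$ is arc-connected, and if $a_n\ge 2k-1$ then $\underline{a}$ is arc-disconnected.
   Context: The list $G_n$ of words $a_1\cdots a_n$ (with $1\le a_i\le 2i-1$) is defined recursively: $G_1=(1)$; for $n\ge2$, if $G_{n-1}=(w_1,\ldots,w_N)$, then $G_n$ is the concatenation over $m=1,\ldots,N$ of the blocks (runs) $(w_m1,\ldots,w_m(2n-1))$ for $m$ odd and $(w_m(2n-1),\ldots,w_m1)$ for $m$ even, where $w_mx$ denotes $w_m$ with the letter $x$ appended. For a word $a_1\cdots a_n$ with $1\le a_i\le 2i-1$, the standard permutation $\pi(a_1\cdots a_n)$ of $\{\pm1,\ldots,\pm n\}$ is defined recursively: $\pi(a_1)=(1,-1)$, and for $n\ge2$, $\pi(a_1\cdots a_n)$ is obtained from $\pi(a_1\cdots a_{n-1})$ (length $2n-2$) by inserting $n$ so that it occupies position $a_n$ and then appending $-n$ at the end. A permutation $\pi$ of $\{\pm1,\ldots,\pm n\}$ is sign-connected if for every $1\le m<2n$ there is $j$ with $|\{\pi(1),\ldots,\pi(m)\}\cap\{ -j,j\}|=1$. A word $\underline{a}$ is arc-connected if $\pi(\underline{a})$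 is sign-connected, and arc-disconnected otherwise. -}

module Defs where

open import Data.Nat using (ℕ; zero; suc; _+_; _*_; _∸_; _≤_; _<_)
open import Data.Bool using (Bool; true; false; if_then_else_; not)
open import Data.List using (List; []; _∷_; _++_; [_]; map; concat; reverse; upTo; length; take)
open import Data.Integer as ℤ using (ℤ; +_)
open import Data.List.Membership.Propositional using (_∈_)
open import Data.Product using (_×_; ∃-syntax)
open import Data.Sum using (_⊎_)
open import Relation.Nullary using (¬_)
open import Relation.Binary.PropositionalEquality using (_≡_)

-- Words a₁⋯aₙ are lists of naturals, a₁ first.

oneTo : ℕ → List ℕ
oneTo M = map suc (upTo M)

-- Given M = 2n-1 and the list G_{n-1} = (w₁,…,w_N), build the runs of G_n:
-- (w_m 1, …, w_m M) for m odd and (w_m M, …, w_m 1) for m even.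
-- The Bool flag records whether the current index m is odd.
mkRuns : ℕ → Bool → List (List ℕ) → List (List (List ℕ))
mkRuns M odd [] = []
mkRuns M odd (w ∷ ws) =
  map (λ x → w ++ [ x ]) (if odd then oneTo M else reverse (oneTo M))
  ∷ mkRuns M (not odd) ws

-- The list G_n (for n ≥ 1; G 0 is an irrelevant empty list).
G : ℕ → List (List ℕ)
G zero = []
G (suc zero) = [ 1 ∷ [] ]
G (suc (suc n)) = concat (mkRuns (2 * suc (suc n) ∸ 1) true (G (suc n)))

runs : ℕ → List (List (List ℕ))
runs zero = []
runs (suc zero) = []
runs (suc (suc n)) = mkRuns (2 * suc (suc n) ∸ 1) true (G (suc n))

-- Insert x so that it occupies (0-indexed) position i.
insertAt : {A : Set} → ℕ → A → List A → List A
insertAt zero x l = x ∷ l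
insertAt (suc i) x [] = x ∷ []
insertAt (suc i) x (y ∷ ys) = y ∷ insertAt i x ys

-- stdAux i π as : π is the standard permutation of the first i letters
-- (a list of length 2i); process the remaining letters as.
stdAux : ℕ → List ℤ → List ℕ → List ℤ
stdAux i π [] = π
stdAux i π (a ∷ as) =
  stdAux (suc i) (insertAt (a ∸ 1) (+ suc i) π ++ [ ℤ.- (+ suc i) ]) as

-- The standard permutation π(a₁⋯aₙ), as the list (π(1),…,π(2n)).
-- π(a₁) = (1,-1); then insert n at position aₙ (1-indexed) and append -n.
std : List ℕ → List ℤ
std [] = []
std (a ∷ as) = stdAux 1 (+ 1 ∷ ℤ.- (+ 1) ∷ []) as

SignConnected : ℕ → List ℤ → Set
SignConnected n π =
  ∀ m → 1 ≤ m → m < 2 * n →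
  ∃[ j ] (1 ≤ j ×
    ((+ j ∈ take m π × ¬ (ℤ.- (+ j) ∈ take m π))
     ⊎ (¬ (+ j ∈ take m π) × ℤ.- (+ j) ∈ take m π)))

ArcConnected : List ℕ → Set
ArcConnected w = SignConnected (length w) (std w)

ArcDisconnected : List ℕ → Set
ArcDisconnected w = ¬ ArcConnected w

-- The j-th letter a_j (1-indexed; 0 outside the word).
letter : List ℕ → ℕ → ℕ
letter [] j = 0
letter (a ∷ as) zero = 0
letter (a ∷ as) (suc zero) = a
letter (a ∷ as) (suc (suc j)) = letter as (suc j)

Good : List ℕ → ℕ → ℕ → Set
Good a n k' = ∀ j → k' ≤ j → j ≤ n ∸ 1 → 2 * k' ∸ 1 ≤ letter a j

IsKIndex : List ℕ → ℕ → ℕ → Set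
IsKIndex a n k =
  (2 ≤ k × k ≤ n ∸ 1 × Good a n k × (∀ k' → 2 ≤ k' → k' < k → ¬ Good a n k'))
  ⊎ (k ≡ n × (∀ k' → 2 ≤ k' → k' ≤ n ∸ 1 → ¬ Good a n k'))

module Submission where

-- Let b = a₁⋯a_N be a word and π = π(b).  A prefix of π of
-- length m is *witnessed* if it contains exactly one of ±j for some j ≥ 1,
-- and *balanced* if it is closed under negation; a witnessed prefix is never
-- balanced.  We prove, by induction along the recursive construction of π,
-- the following characterisation (the record StdInvariant):
--   a prefix of length m (1 ≤ m ≤ 2N) is unwitnessed only if m = 2t with
--   a_{t+1}, …, a_N ≥ 2t+1 (a *cut*), and the prefix of length 2t is
--   balanced whenever a_{t+1}, …, a_N ≥ 2t+1.
-- Inserting N+1 at position x and appending -(N+1) witnesses every new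
-- prefix that reaches N+1, and leaves the shorter prefixes untouched, which
-- is exactly what the letter condition a_{N+1} = x ≥ 2t+1 records.
-- Hence π(a) is sign-connected iff a has no cut with 1 ≤ t < n.  Writing
-- k' = t+1, a cut is an index k' ≥ 2 with a_{k'},…,a_n ≥ 2k'-1, and the
-- definition of k turns this into the comparison of a_n with 2k-1.

open import Defs
open import Data.Nat using (ℕ; zero; suc; _+_; _*_; _∸_; _≤_; _<_; z≤n; s≤s; _≤?_; pred)
open import Data.Nat.Properties
open import Data.List using (List; []; _∷_; _++_; [_]; take; length)
open import Data.List.Properties using (length-++; take-all; ++-assoc; ++-identityʳ)
open import Data.List.Membership.Propositional using (_∈_)
open import Data.List.Membership.Propositional.Properties using (∈-map⁻; ∈-++⁻; ∈-concat⁻′; ∈-++⁺ˡ; ∈-++⁺ʳ)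
open import Data.List.Relation.Binary.Sublist.Propositional.Properties using (Any-resp-⊆; take-⊆)
open import Data.List.Relation.Unary.Any using (here; there)
open import Data.Integer as ℤ using (ℤ; +_)
open import Data.Integer.Properties using (neg-involutive)
open import Data.Bool using (true; not)
open import Data.Product using (_×_; _,_; ∃-syntax)
open import Data.Sum using (_⊎_; inj₁; inj₂) renaming (map to ⊎-map; map₂ to ⊎-map₂)
open import Data.Empty using (⊥-elim)
open import Relation.Nullary using (¬_; yes; no)
open import Relation.Binary.PropositionalEquality using (_≡_; refl; sym; trans; cong; subst)

2*suc∸1 : ∀ t → 2 * suc t ∸ 1 ≡ suc (2 * t)
2*suc∸1 t = cong (_∸ 1) (*-suc 2 t)

≤pred⇒< : ∀ {m x} → 1 ≤ m → m ≤ pred x → m < x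
≤pred⇒< {x = zero}  (s≤s _) ()
≤pred⇒< {x = suc x} _       m≤x = s≤s m≤x

pred<⇒≤ : ∀ {n m} → pred n < m → n ≤ m
pred<⇒≤ {zero}  _ = z≤n
pred<⇒≤ {suc n} n<m = n<m

length-snoc : ∀ {A : Set} (w : List A) x → length (w ++ [ x ]) ≡ suc (length w)
length-snoc w x = trans (length-++ w) (+-comm (length w) 1)

take-++ˡ : ∀ {A : Set} m (l r : List A) → m ≤ length l → take m (l ++ r) ≡ take m l
take-++ˡ zero    l       r _         = refl
take-++ˡ (suc m) (w ∷ l) r (s≤s m≤l) = cong (w ∷_) (take-++ˡ m l r m≤l)

∈-take : ∀ {A : Set} m {z : A} {l} → z ∈ take m l → z ∈ l
∈-take m {l = l} = Any-resp-⊆ (take-⊆ m l)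

module _ {A : Set} where

  length-insertAt : ∀ p (y : A) l → length (insertAt p y l) ≡ suc (length l)
  length-insertAt zero    y l       = refl
  length-insertAt (suc p) y []      = refl
  length-insertAt (suc p) y (w ∷ l) = cong suc (length-insertAt p y l)

  ∈-insertAt⁻ : ∀ p {y z : A} l → z ∈ insertAt p y l → z ≡ y ⊎ z ∈ l
  ∈-insertAt⁻ zero    l       (here e)  = inj₁ e
  ∈-insertAt⁻ zero    l       (there i) = inj₂ i
  ∈-insertAt⁻ (suc p) []      (here e)  = inj₁ e
  ∈-insertAt⁻ (suc p) (w ∷ l) (here e)  = inj₂ (here e)
  ∈-insertAt⁻ (suc p) (w ∷ l) (there i) with ∈-insertAt⁻ p l i
  ... | inj₁ e  = inj₁ e
  ... | inj₂ i′ = inj₂ (there i′)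

  ∈-insertAt⁺ : ∀ p (y : A) {z l} → z ∈ l → z ∈ insertAt p y l
  ∈-insertAt⁺ zero    y i         = there i
  ∈-insertAt⁺ (suc p) y (here e)  = here e
  ∈-insertAt⁺ (suc p) y (there i) = there (∈-insertAt⁺ p y i)

  ∈-take-insertAt : ∀ m p (y : A) l → p < m ⊎ length l < m → y ∈ take m (insertAt p y l)
  ∈-take-insertAt zero    p       y l       (inj₁ ())
  ∈-take-insertAt zero    p       y l       (inj₂ ())
  ∈-take-insertAt (suc m) zero    y l       _                = here refl
  ∈-take-insertAt (suc m) (suc p) y []      _                = here refl
  ∈-take-insertAt (suc m) (suc p) y (w ∷ l) (inj₁ (s≤s p<m)) = there (∈-take-insertAt m p y l (inj₁ p<m))
  ∈-take-insertAt (suc m) (suc p) y (w ∷ l) (inj₂ (s≤s l<m)) = there (∈-take-insertAt m p y l (inj₂ l<m))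

  take-insertAt : ∀ m p (y : A) l → m ≤ p → m ≤ length l → take m (insertAt p y l) ≡ take m l
  take-insertAt zero    p       y l       _         _         = refl
  take-insertAt (suc m) (suc p) y (w ∷ l) (s≤s m≤p) (s≤s m≤l) = cong (w ∷_) (take-insertAt m p y l m≤p m≤l)

  ∈-insertAt-self : ∀ p (y : A) l → y ∈ insertAt p y l
  ∈-insertAt-self zero    y l       = here refl
  ∈-insertAt-self (suc p) y []      = here refl
  ∈-insertAt-self (suc p) y (w ∷ l) = there (∈-insertAt-self p y l)

letter-snoc : ∀ b x {l} → l ≤ length b → letter (b ++ [ x ]) l ≡ letter b l
letter-snoc []       x {zero}        _         = refl
letter-snoc (c ∷ cs) x {zero}        _         = refl
letter-snoc (c ∷ cs) x {suc zero}    _         = refl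
letter-snoc (c ∷ cs) x {suc (suc l)} (s≤s l≤n) = letter-snoc cs x l≤n

letter-last : ∀ b x → letter (b ++ [ x ]) (suc (length b)) ≡ x
letter-last []       x = refl
letter-last (c ∷ cs) x = letter-last cs x

-- LettersFrom b N k: the letters a_k, …, a_N of b are all at least 2k-1.
-- Good a n k of the statement is LettersFrom a (n ∸ 1) k.
LettersFrom : List ℕ → ℕ → ℕ → Set
LettersFrom b N k = ∀ j → k ≤ j → j ≤ N → 2 * k ∸ 1 ≤ letter b j

lettersFrom-restrict : ∀ {b N N′ k} → N′ ≤ N → LettersFrom b N k → LettersFrom b N′ k
lettersFrom-restrict N′≤N lf j k≤j j≤N′ = lf j k≤j (≤-trans j≤N′ N′≤N)

lettersFrom-vacuous : ∀ {b N k} → N < k → LettersFrom b N k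
lettersFrom-vacuous N<k j k≤j j≤N = ⊥-elim (<⇒≱ N<k (≤-trans k≤j j≤N))

lettersFrom-suc : ∀ {b N k} → LettersFrom b N k → 2 * k ∸ 1 ≤ letter b (suc N) → LettersFrom b (suc N) k
lettersFrom-suc lf last j k≤j j≤1+N with m≤n⇒m<n∨m≡n j≤1+N
... | inj₁ (s≤s j≤N) = lf j k≤j j≤N
... | inj₂ refl      = last

lettersFrom-snoc⁺ : ∀ {N k} b x → length b ≡ N → LettersFrom b N k → LettersFrom (b ++ [ x ]) N k
lettersFrom-snoc⁺ b x refl lf j k≤j j≤N = subst (_ ≤_) (sym (letter-snoc b x j≤N)) (lf j k≤j j≤N)

lettersFrom-snoc⁻ : ∀ {N k} b x → length b ≡ N → LettersFrom (b ++ [ x ]) N k → LettersFrom b N k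
lettersFrom-snoc⁻ b x refl lf j k≤j j≤N = subst (_ ≤_) (letter-snoc b x j≤N) (lf j k≤j j≤N)

lettersFrom-extend : ∀ {N k x} b → length b ≡ N → LettersFrom b N k → 2 * k ∸ 1 ≤ x →
  LettersFrom (b ++ [ x ]) (suc N) k
lettersFrom-extend {x = x} b refl lf x≥ =
  lettersFrom-suc {b = b ++ [ x ]} (lettersFrom-snoc⁺ b x refl lf) (subst (_ ≤_) (sym (letter-last b x)) x≥)

lettersFrom-last : ∀ {N k x} b → length b ≡ N → k ≤ suc N → LettersFrom (b ++ [ x ]) (suc N) k →
  2 * k ∸ 1 ≤ x
lettersFrom-last {x = x} b refl k≤1+N lf = subst (_ ≤_) (letter-last b x) (lf (suc (length b)) k≤1+N ≤-refl)

lettersFrom-init : ∀ {N k x} b → length b ≡ N → LettersFrom (b ++ [ x ]) (suc N) k → LettersFrom b N k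
lettersFrom-init {x = x} b lb lf = lettersFrom-snoc⁻ b x lb (lettersFrom-restrict {b = b ++ [ x ]} (n≤1+n _) lf)

Balanced : List ℤ → Set
Balanced l = ∀ z → z ∈ l → ℤ.- z ∈ l

-- A list is witnessed if it contains exactly one of j, -j for some j ≥ 1;
-- SignConnected n π says every proper prefix take m π is witnessed.
Witnessed : List ℤ → Set
Witnessed l = ∃[ j ] (1 ≤ j × ((+ j ∈ l × ¬ (ℤ.- (+ j) ∈ l)) ⊎ (¬ (+ j ∈ l) × ℤ.- (+ j) ∈ l)))

witnessed⇒¬balanced : ∀ {l} → Witnessed l → ¬ Balanced l
witnessed⇒¬balanced (j , _ , inj₁ (j∈ , -j∉)) bal = -j∉ (bal _ j∈)
witnessed⇒¬balanced {l} (j , _ , inj₂ (j∉ , -j∈)) bal = j∉ (subst (_∈ l) (neg-involutive (+ j)) (bal _ -j∈))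

Cut : List ℕ → ℕ → ℕ → Set
Cut b N m = ∃[ t ] (m ≡ 2 * t × 1 ≤ t × LettersFrom b N (suc t))

record StdInvariant (b : List ℕ) (N : ℕ) (π : List ℤ) : Set where
  field
    length-π          : length π ≡ 2 * N
    bounded           : ∀ z → z ∈ π → ℤ.∣ z ∣ ≤ N
    balanced          : Balanced π
    witnessed-or-cut  : ∀ m → 1 ≤ m → m ≤ 2 * N → Witnessed (take m π) ⊎ Cut b N m
    balanced-at-cut   : ∀ t → t ≤ N → LettersFrom b N (suc t) → Balanced (take (2 * t) π)

extend : ℕ → List ℤ → ℕ → List ℤ
extend N π x = insertAt (x ∸ 1) (+ suc N) π ++ [ ℤ.- (+ suc N) ]

module Extend {b N π} (x : ℕ) (lb : length b ≡ N) (inv : StdInvariant b N π) where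
  open StdInvariant inv

  new : ℤ
  new = + suc N

  inserted : List ℤ
  inserted = insertAt (x ∸ 1) new π

  length-inserted : length inserted ≡ suc (2 * N)
  length-inserted = trans (length-insertAt (x ∸ 1) new π) (cong suc length-π)

  length-extend : length (extend N π x) ≡ 2 * suc N
  length-extend = trans (length-snoc inserted _) (trans (cong suc length-inserted) (sym (*-suc 2 N)))

  -- By the bound on π, the entry -(N+1) occurs only at the very end.
  -new∉inserted : ¬ (ℤ.- new ∈ inserted)
  -new∉inserted i with ∈-insertAt⁻ (x ∸ 1) π i
  ... | inj₁ ()
  ... | inj₂ i′ = n≮n N (bounded _ i′)

  ∈-extend : ∀ {z} → z ∈ π → z ∈ extend N π x
  ∈-extend i = ∈-++⁺ˡ (∈-insertAt⁺ (x ∸ 1) new i)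

  bounded-extend : ∀ z → z ∈ extend N π x → ℤ.∣ z ∣ ≤ suc N
  bounded-extend z i with ∈-++⁻ inserted i
  ... | inj₂ (here refl) = ≤-refl
  ... | inj₁ i′ with ∈-insertAt⁻ (x ∸ 1) π i′
  ...   | inj₁ refl = ≤-refl
  ...   | inj₂ i″   = m≤n⇒m≤1+n (bounded z i″)

  balanced-extend : Balanced (extend N π x)
  balanced-extend z i with ∈-++⁻ inserted i
  ... | inj₂ (here refl) = ∈-++⁺ˡ (∈-insertAt-self (x ∸ 1) new π)
  ... | inj₁ i′ with ∈-insertAt⁻ (x ∸ 1) π i′
  ...   | inj₁ refl = ∈-++⁺ʳ inserted (here refl)
  ...   | inj₂ i″   = ∈-extend (balanced z i″)

  take-extend : ∀ m → m ≤ suc (2 * N) → take m (extend N π x) ≡ take m inserted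
  take-extend m m≤ = take-++ˡ m inserted _ (subst (m ≤_) (sym length-inserted) m≤)

  take-extend-old : ∀ m → m ≤ x ∸ 1 → m ≤ 2 * N → take m (extend N π x) ≡ take m π
  take-extend-old m m≤p m≤2N =
    trans (take-extend m (m≤n⇒m≤1+n m≤2N))
          (take-insertAt m (x ∸ 1) new π m≤p (subst (m ≤_) (sym length-π) m≤2N))

  witnessed-new : ∀ m → m ≤ suc (2 * N) → x ∸ 1 < m ⊎ 2 * N < m → Witnessed (take m (extend N π x))
  witnessed-new m m≤ reach = suc N , s≤s z≤n , inj₁ (new∈ , -new∉)
    where
    reach′ : x ∸ 1 < m ⊎ length π < m
    reach′ = ⊎-map₂ (subst (_< m) (sym length-π)) reach
    new∈ : new ∈ take m (extend N π x)
    new∈ = subst (new ∈_) (sym (take-extend m m≤)) (∈-take-insertAt m (x ∸ 1) new π reach′)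
    -new∉ : ¬ (ℤ.- new ∈ take m (extend N π x))
    -new∉ i = -new∉inserted (∈-take m (subst (ℤ.- new ∈_) (take-extend m m≤) i))

  -- A cut of b below position x is still a cut of b x, since x ≥ 2t+1.
  cut-extend : ∀ {m} → m ≤ x ∸ 1 → Cut b N m → Cut (b ++ [ x ]) (suc N) m
  cut-extend m≤p (t , refl , 1≤t , lf) =
    t , refl , 1≤t , lettersFrom-extend b lb lf (subst (_≤ x) (sym (2*suc∸1 t)) (≤pred⇒< 1≤2t m≤p))
    where
    1≤2t : 1 ≤ 2 * t
    1≤2t = ≤-trans 1≤t (m≤m+n t (t + 0))

  -- Prefixes of length at most 2N+1: old prefixes keep their status, the others are new.
  witnessed-or-cut-short : ∀ m → 1 ≤ m → m ≤ suc (2 * N) →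
    Witnessed (take m (extend N π x)) ⊎ Cut (b ++ [ x ]) (suc N) m
  witnessed-or-cut-short m 1≤m m≤ with m ≤? x ∸ 1 | m ≤? 2 * N
  ... | no m≰p  | _        = inj₁ (witnessed-new m m≤ (inj₁ (≰⇒> m≰p)))
  ... | yes _   | no m≰2N  = inj₁ (witnessed-new m m≤ (inj₂ (≰⇒> m≰2N)))
  ... | yes m≤p | yes m≤2N =
    ⊎-map (subst Witnessed (sym (take-extend-old m m≤p m≤2N))) (cut-extend m≤p)
          (witnessed-or-cut m 1≤m m≤2N)

  -- The whole list, of length 2(N+1), is the cut t = N+1.
  witnessed-or-cut-extend : ∀ m → 1 ≤ m → m ≤ 2 * suc N →
    Witnessed (take m (extend N π x)) ⊎ Cut (b ++ [ x ]) (suc N) m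
  witnessed-or-cut-extend m 1≤m m≤ with m≤n⇒m<n∨m≡n m≤
  ... | inj₂ refl = inj₂ (suc N , refl , s≤s z≤n , lettersFrom-vacuous {b = b ++ [ x ]} (n<1+n (suc N)))
  ... | inj₁ m<   = witnessed-or-cut-short m 1≤m (subst (m ≤_) (2*suc∸1 N) (<⇒≤pred m<))

  balanced-at-cut-extend : ∀ t → t ≤ suc N → LettersFrom (b ++ [ x ]) (suc N) (suc t) →
    Balanced (take (2 * t) (extend N π x))
  balanced-at-cut-extend t t≤ lf with m≤n⇒m<n∨m≡n t≤
  ... | inj₂ refl = subst Balanced (sym (take-all _ _ (≤-reflexive length-extend))) balanced-extend
  ... | inj₁ (s≤s t≤N) =
    subst Balanced (sym (take-extend-old (2 * t) 2t≤p 2t≤2N)) (balanced-at-cut t t≤N (lettersFrom-init b lb lf))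
    where
    2t≤p : 2 * t ≤ x ∸ 1
    2t≤p = <⇒≤pred (subst (_≤ x) (2*suc∸1 t) (lettersFrom-last b lb (s≤s t≤N) lf))
    2t≤2N : 2 * t ≤ 2 * N
    2t≤2N = *-monoʳ-≤ 2 t≤N

extend-invariant : ∀ {b N π} x → length b ≡ N → StdInvariant b N π →
  StdInvariant (b ++ [ x ]) (suc N) (extend N π x)
extend-invariant x lb inv = record
  { length-π         = length-extend
  ; bounded          = bounded-extend
  ; balanced         = balanced-extend
  ; witnessed-or-cut = witnessed-or-cut-extend
  ; balanced-at-cut  = balanced-at-cut-extend
  }
  where open Extend x lb inv

empty-invariant : StdInvariant [] 0 []
empty-invariant = record
  { length-π         = refl
  ; bounded          = λ _ ()
  ; balanced         = λ _ ()
  ; witnessed-or-cut = λ { zero () _ ; (suc m) _ () }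
  ; balanced-at-cut  = λ { zero _ _ _ () }
  }

-- π(a₁) = (1, -1) is the first extend step, whatever a₁ is.
extend-empty : ∀ a → extend 0 [] a ≡ + 1 ∷ ℤ.- (+ 1) ∷ []
extend-empty a with a ∸ 1
... | zero  = refl
... | suc _ = refl

stdAux-invariant : ∀ as {b i π} → length b ≡ i → StdInvariant b i π →
  StdInvariant (b ++ as) (i + length as) (stdAux i π as)
stdAux-invariant [] {b} {i} _ inv rewrite ++-identityʳ b | +-identityʳ i = inv
stdAux-invariant (x ∷ as) {b} {i} lb inv rewrite +-suc i (length as) | sym (++-assoc b [ x ] as) =
  stdAux-invariant as (trans (length-snoc b x) (cong suc lb)) (extend-invariant x lb inv)

std-invariant : ∀ a → 1 ≤ length a → StdInvariant a (length a) (std a)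
std-invariant (a ∷ as) _ = stdAux-invariant as refl first-letter
  where
  first-letter : StdInvariant [ a ] 1 (+ 1 ∷ ℤ.- (+ 1) ∷ [])
  first-letter = subst (StdInvariant [ a ] 1) (extend-empty a) (extend-invariant a refl empty-invariant)

no-cut⇒signConnected : ∀ {b N π} → StdInvariant b N π →
  (∀ t → 1 ≤ t → t < N → ¬ LettersFrom b N (suc t)) → SignConnected N π
no-cut⇒signConnected inv no-cut m 1≤m m<2N with StdInvariant.witnessed-or-cut inv m 1≤m (<⇒≤ m<2N)
... | inj₁ witnessed              = witnessed
... | inj₂ (t , refl , 1≤t , lf) = ⊥-elim (no-cut t 1≤t (*-cancelˡ-< 2 t _ m<2N) lf)

cut⇒¬signConnected : ∀ {b N π t} → StdInvariant b N π →
  1 ≤ t → t < N → LettersFrom b N (suc t) → ¬ SignConnected N π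
cut⇒¬signConnected {t = t} inv 1≤t t<N lf sc =
  witnessed⇒¬balanced (sc (2 * t) 1≤2t (*-monoʳ-< 2 t<N))
                      (StdInvariant.balanced-at-cut inv t (<⇒≤ t<N) lf)
  where
  1≤2t : 1 ≤ 2 * t
  1≤2t = ≤-trans 1≤t (m≤m+n t (t + 0))

kIndex-bounds : ∀ {a n k} → 2 ≤ n → IsKIndex a n k → 2 ≤ k × k ≤ n
kIndex-bounds {n = n} _   (inj₁ (2≤k , k≤n-1 , _)) = 2≤k , ≤-trans k≤n-1 (m∸n≤m n 1)
kIndex-bounds         2≤n (inj₂ (refl , _))        = 2≤n , ≤-refl

-- k itself satisfies the letter condition (vacuously when k = n).
kIndex-good : ∀ {a n k} → 1 ≤ n → IsKIndex a n k → Good a n k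
kIndex-good         _       (inj₁ (_ , _ , good , _)) = good
kIndex-good {a} {suc n} _   (inj₂ (refl , _))         = lettersFrom-vacuous {b = a} (n<1+n n)

kIndex-minimal : ∀ {a n k k′} → IsKIndex a n k → 2 ≤ k′ → k′ ≤ n → Good a n k′ → k ≤ k′
kIndex-minimal {k = k} {k′} (inj₁ (_ , _ , _ , smaller-bad)) 2≤k′ _ good with k ≤? k′
... | yes k≤k′ = k≤k′
... | no  k≰k′ = ⊥-elim (smaller-bad k′ 2≤k′ (≰⇒> k≰k′) good)
kIndex-minimal {n = n} {k′ = k′} (inj₂ (refl , all-bad)) 2≤k′ _ good with k′ ≤? n ∸ 1
... | yes k′≤n-1 = ⊥-elim (all-bad k′ 2≤k′ k′≤n-1 good)
... | no  k′≰n-1 = pred<⇒≤ (≰⇒> k′≰n-1)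

-- Used with x = 2k: the bounds 2k-2 and 2k-1 on a_n are exclusive.
∸2<∸1 : ∀ x → 2 ≤ x → x ∸ 2 < x ∸ 1
∸2<∸1 (suc zero)    (s≤s ())
∸2<∸1 (suc (suc x)) _ = n<1+n x

-- If a_n ≤ 2k-2 there is no cut: a cut t gives the good index t+1 ≥ k, and
-- then a_n ≥ 2t+1 ≥ 2k-1.
kIndex-connected : ∀ {a n k π} → StdInvariant a n π → IsKIndex a n k →
  letter a n ≤ 2 * k ∸ 2 → SignConnected n π
kIndex-connected {a} {n} {k} inv isK small = no-cut⇒signConnected inv no-cut
  where
  no-cut : ∀ t → 1 ≤ t → t < n → ¬ LettersFrom a n (suc t)
  no-cut t 1≤t t<n lf = <⇒≱ (∸2<∸1 (2 * k) (*-monoʳ-≤ 2 (≤-trans (s≤s z≤n) 2≤k))) 2k-1≤2k-2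
    where
    2≤k : 2 ≤ k
    2≤k with kIndex-bounds {a = a} (≤-trans (s≤s 1≤t) t<n) isK
    ... | 2≤k , _ = 2≤k
    k≤t+1 : k ≤ suc t
    k≤t+1 = kIndex-minimal {a = a} isK (s≤s 1≤t) t<n (lettersFrom-restrict {b = a} (m∸n≤m n 1) lf)
    2k-1≤2k-2 : 2 * k ∸ 1 ≤ 2 * k ∸ 2
    2k-1≤2k-2 = ≤-trans (∸-monoˡ-≤ 1 (*-monoʳ-≤ 2 k≤t+1)) (≤-trans (lf n t<n ≤-refl) small)

-- If a_n ≥ 2k-1 then t = k-1 is a cut.
kIndex-disconnected : ∀ {a n k π} → 2 ≤ n → StdInvariant a n π → IsKIndex a n k →
  2 * k ∸ 1 ≤ letter a n → ¬ SignConnected n π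
kIndex-disconnected {a} {suc n} 2≤n inv isK large with kIndex-bounds {a = a} 2≤n isK
... | s≤s 1≤t , k≤n =
  cut⇒¬signConnected inv 1≤t k≤n (lettersFrom-suc {b = a} (kIndex-good {a = a} (s≤s z≤n) isK) large)

mkRuns-length : ∀ M o ws {L r a} → (∀ {w} → w ∈ ws → length w ≡ L) →
  r ∈ mkRuns M o ws → a ∈ r → length a ≡ suc L
mkRuns-length M o (w ∷ ws) len-ws (here refl) a∈r with ∈-map⁻ (λ x → w ++ [ x ]) a∈r
... | x , _ , refl = trans (length-snoc w x) (cong suc (len-ws (here refl)))
mkRuns-length M o (w ∷ ws) len-ws (there r∈) a∈r = mkRuns-length M (not o) ws (λ w∈ → len-ws (there w∈)) r∈ a∈r

G-length : ∀ n {w} → w ∈ G n → length w ≡ n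
G-length (suc zero)    (here refl) = refl
G-length (suc (suc n)) w∈ =
  let r , w∈r , r∈ = ∈-concat⁻′ (mkRuns _ true (G (suc n))) w∈
  in mkRuns-length _ _ (G (suc n)) (G-length (suc n)) r∈ w∈r

runs-length : ∀ n {r a} → r ∈ runs n → a ∈ r → length a ≡ n
runs-length (suc (suc n)) r∈ a∈r = mkRuns-length _ _ (G (suc n)) (G-length (suc n)) r∈ a∈r

lemma5p7 : (n : ℕ) → 2 ≤ n → (r : List (List ℕ)) → r ∈ runs n →
    (a : List ℕ) → a ∈ r → (k : ℕ) → IsKIndex a n k →
    (letter a n ≤ 2 * k ∸ 2 → ArcConnected a)
    × (2 * k ∸ 1 ≤ letter a n → ArcDisconnected a)
lemma5p7 n 2≤n r r∈runs a a∈r k isK with runs-length n r∈runs a∈r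
... | refl = kIndex-connected inv isK , kIndex-disconnected 2≤n inv isK
  where
  inv : StdInvariant a (length a) (std a)
  inv = std-invariant a (≤-trans (n≤1+n 1) 2≤n)
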